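{- As $q\to\infty$, the fraction of subsets of $\mathbb{F}_q^2$ that are blocking sets tends to $1$.
   Context: For $(i,j)\in\mathbb{F}_q^2$, the non-vertical line $\ell_{(i,j)}$ is $\{(t,i+jt):t\in\mathbb{F}_q\}$. A subset $S\subseteq\mathbb{F}_q^2$ is a blocking set if it intersects every non-vertical line. -}

module Defs where

open import Level using (Level)
open import Data.Nat using (ℕ; zero; suc; _+_; _*_)
open import Data.Fin using (Fin; combine)
open import Data.Fin.Subset using (Subset; _∈_; inside; outside)
open import Data.Fin.Subset.Properties using (_∈?_)
open import Data.Fin.Properties using (any?; all?)
open import Data.Vec using ([]; _∷_)
open import Data.Product using (∃; ∃-syntax)
open import Relation.Binary.PropositionalEquality using (_≡_)
open import Relation.Nullary using (¬_; Dec; yes; no)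
open import Relation.Unary using (Pred; Decidable)
open import Algebra.Structures using (IsCommutativeRing)

record FiniteField (q : ℕ) : Set where
  field
    _+F_ : Fin q → Fin q → Fin q
    _*F_ : Fin q → Fin q → Fin q
    -F_  : Fin q → Fin q
    0F   : Fin q
    1F   : Fin q
    isCommutativeRing : IsCommutativeRing _≡_ _+F_ _*F_ -F_ 0F 1F
    0≢1  : ¬ (0F ≡ 1F)
    inverse : ∀ x → ¬ (x ≡ 0F) → ∃[ y ] (x *F y ≡ 1F)

-- The point (x , y) of F_q² seen as an element of Fin (q * q).
point : ∀ {q} → Fin q → Fin q → Fin (q * q)
point x y = combine x y

-- S meets the non-vertical line ℓ_(i,j) = {(t, i + j t) : t ∈ F_q}.
MeetsLine : ∀ {q} (F : FiniteField q) → Subset (q * q) → Fin q → Fin q → Set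
MeetsLine F S i j = ∃[ t ] (point t (i +F (j *F t)) ∈ S)
  where open FiniteField F

IsBlockingSet : ∀ {q} (F : FiniteField q) → Subset (q * q) → Set
IsBlockingSet F S = ∀ i j → MeetsLine F S i j

isBlockingSet? : ∀ {q} (F : FiniteField q) → Decidable (IsBlockingSet F)
isBlockingSet? F S = all? (λ i → all? (λ j → any? (λ t → point t (i +F (j *F t)) ∈? S)))
  where open FiniteField F

countSubsets : ∀ {ℓ : Level} n {P : Pred (Subset n) ℓ} → Decidable P → ℕ
countSubsets zero P? with P? []
... | yes _ = 1
... | no _  = 0
countSubsets (suc n) P? =
  countSubsets n (λ s → P? (inside ∷ s)) + countSubsets n (λ s → P? (outside ∷ s))

numBlockingSets : ∀ {q} → FiniteField q → ℕ
numBlockingSets {q} F = countSubsets (q * q) (isBlockingSet? F)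

-- A set fails to be blocking exactly when it avoids some non-vertical line. A line has q
-- distinct points, so 2 ^ (q² − q) subsets avoid it, and the union bound over the q² lines
-- leaves at most a fraction q² / 2 ^ q of non-blocking sets; this is at most 1/(k+1) once
-- q ≥ k + 10, because q³ ≤ 2 ^ q for q ≥ 10.

module Submission where

open import Defs
open import Level using (Level; 0ℓ)
open import Data.Nat using (ℕ; zero; suc; _+_; _*_; _^_; _≤_; z≤n; NonZero)
open import Data.Nat.Properties
open import Algebra.Properties.CommutativeSemigroup +-commutativeSemigroup
  using () renaming (interchange to +-interchange)
open import Algebra.Properties.CommutativeSemigroup *-commutativeSemigroup using (x∙yz≈y∙xz)
open import Data.Nat.Tactic.RingSolver using (solve-∀)
open import Data.Fin using (Fin) renaming (zero to fzero; suc to fsuc)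
open import Data.Fin.Properties using (all?; any?; ∀-cons; ¬∀⟶∃¬; combine-injectiveˡ)
import Data.Fin.Properties as Finₚ
open import Data.Fin.Subset using (Subset; _∈_; _∉_; inside; outside)
open import Data.Fin.Subset.Properties using (_∈?_)
open import Data.Vec using (_∷_; []; _[_]≔_; here; there)
open import Data.Vec.Properties using (lookup∘update′; lookup⇒[]=; []=⇒lookup)
open import Data.Product using (∃-syntax; _,_; proj₁)
open import Data.Sum using (inj₁; inj₂)
open import Data.Empty using (⊥-elim)
open import Function using (_∘_; Injective)
open import Relation.Nullary using (¬_; yes; no; ¬?)
open import Relation.Unary using (Pred; Decidable; _⊆_; _≐_; _∪_; _∩_; ∁; ⋃)
open import Relation.Unary.Properties using (U?; ∅?; ∁?; _∪?_; _∩?_)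
open import Relation.Binary.PropositionalEquality

private
  variable
    ℓ ℓ′ : Level

countSubsets-mono : ∀ n {P : Pred (Subset n) ℓ} {Q : Pred (Subset n) ℓ′}
                    (P? : Decidable P) (Q? : Decidable Q) →
                    P ⊆ Q → countSubsets n P? ≤ countSubsets n Q?
countSubsets-mono zero P? Q? P⊆Q with P? [] | Q? []
... | yes _ | yes _ = ≤-refl
... | yes p | no ¬q = ⊥-elim (¬q (P⊆Q p))
... | no _  | _     = z≤n
countSubsets-mono (suc n) P? Q? P⊆Q =
  +-mono-≤ (countSubsets-mono n (P? ∘ (inside ∷_)) (Q? ∘ (inside ∷_)) P⊆Q)
           (countSubsets-mono n (P? ∘ (outside ∷_)) (Q? ∘ (outside ∷_)) P⊆Q)

countSubsets-cong : ∀ n {P : Pred (Subset n) ℓ} {Q : Pred (Subset n) ℓ′}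
                    (P? : Decidable P) (Q? : Decidable Q) →
                    P ≐ Q → countSubsets n P? ≡ countSubsets n Q?
countSubsets-cong n P? Q? (P⊆Q , Q⊆P) =
  ≤-antisym (countSubsets-mono n P? Q? P⊆Q) (countSubsets-mono n Q? P? Q⊆P)

countSubsets-∅ : ∀ n → countSubsets n (∅? {A = Subset n}) ≡ 0
countSubsets-∅ zero    = refl
countSubsets-∅ (suc n) = cong₂ _+_ (countSubsets-∅ n) (countSubsets-∅ n)

countSubsets-U : ∀ n → countSubsets n (U? {A = Subset n}) ≡ 2 ^ n
countSubsets-U zero    = refl
countSubsets-U (suc n) rewrite countSubsets-U n = cong (2 ^ n +_) (sym (+-identityʳ (2 ^ n)))

countSubsets-∁ : ∀ n {P : Pred (Subset n) ℓ} (P? : Decidable P) →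
                 countSubsets n P? + countSubsets n (∁? P?) ≡ 2 ^ n
countSubsets-∁ zero P? with P? []
... | yes _ = refl
... | no _  = refl
countSubsets-∁ (suc n) P? = begin
  (a + b) + (c + d)  ≡⟨ +-interchange a b c d ⟩
  (a + c) + (b + d)  ≡⟨ cong₂ _+_ (countSubsets-∁ n (P? ∘ (inside ∷_)))
                                  (countSubsets-∁ n (P? ∘ (outside ∷_))) ⟩
  2 ^ n + 2 ^ n      ≡⟨ cong (2 ^ n +_) (sym (+-identityʳ (2 ^ n))) ⟩
  2 ^ suc n          ∎
  where
  open ≡-Reasoning
  a b c d : ℕ
  a = countSubsets n (P? ∘ (inside ∷_))
  b = countSubsets n (P? ∘ (outside ∷_))
  c = countSubsets n (∁? P? ∘ (inside ∷_))
  d = countSubsets n (∁? P? ∘ (outside ∷_))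

countSubsets-∪ : ∀ n {P : Pred (Subset n) ℓ} {Q : Pred (Subset n) ℓ′}
                 (P? : Decidable P) (Q? : Decidable Q) →
                 countSubsets n (P? ∪? Q?) ≤ countSubsets n P? + countSubsets n Q?
countSubsets-∪ zero P? Q? with P? [] | Q? []
... | yes _ | yes _ = m≤m+n 1 1
... | yes _ | no _  = ≤-refl
... | no _  | yes _ = ≤-refl
... | no _  | no _  = z≤n
countSubsets-∪ (suc n) P? Q? = begin
  countSubsets (suc n) (P? ∪? Q?)
    ≤⟨ +-mono-≤ (countSubsets-∪ n (P? ∘ (inside ∷_)) (Q? ∘ (inside ∷_)))
                (countSubsets-∪ n (P? ∘ (outside ∷_)) (Q? ∘ (outside ∷_))) ⟩
  (a + b) + (c + d)
    ≡⟨ +-interchange a b c d ⟩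
  countSubsets (suc n) P? + countSubsets (suc n) Q? ∎
  where
  open ≤-Reasoning
  a b c d : ℕ
  a = countSubsets n (P? ∘ (inside ∷_))
  b = countSubsets n (Q? ∘ (inside ∷_))
  c = countSubsets n (P? ∘ (outside ∷_))
  d = countSubsets n (Q? ∘ (outside ∷_))

⋃? : ∀ {m} {A : Set} {R : Fin m → Pred A ℓ} →
     (∀ x → Decidable (R x)) → Decidable (⋃ (Fin m) R)
⋃? R? s = any? (λ x → R? x s)

-- The weight a lets the per-line counts enter as 2 ^ q * c ≡ 2 ^ (q * q), avoiding subtraction.
countSubsets-⋃ : ∀ n m {R : Fin m → Pred (Subset n) ℓ} (R? : ∀ x → Decidable (R x))
                 (a : ℕ) {b : ℕ} → (∀ x → a * countSubsets n (R? x) ≤ b) →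
                 a * countSubsets n (⋃? R?) ≤ m * b
countSubsets-⋃ n zero R? a _ = begin
  a * countSubsets n (⋃? R?)
    ≤⟨ *-monoʳ-≤ a (countSubsets-mono n (⋃? R?) ∅? (λ { (() , _) })) ⟩
  a * countSubsets n ∅?
    ≡⟨ cong (a *_) (countSubsets-∅ n) ⟩
  a * 0
    ≡⟨ *-zeroʳ a ⟩
  0 ∎
  where open ≤-Reasoning
countSubsets-⋃ n (suc m) {R} R? a {b} bound = begin
  a * countSubsets n (⋃? R?)
    ≤⟨ *-monoʳ-≤ a (countSubsets-mono n (⋃? R?) (R? fzero ∪? ⋃? (R? ∘ fsuc)) split) ⟩
  a * countSubsets n (R? fzero ∪? ⋃? (R? ∘ fsuc))
    ≤⟨ *-monoʳ-≤ a (countSubsets-∪ n (R? fzero) (⋃? (R? ∘ fsuc))) ⟩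
  a * (countSubsets n (R? fzero) + countSubsets n (⋃? (R? ∘ fsuc)))
    ≡⟨ *-distribˡ-+ a (countSubsets n (R? fzero)) (countSubsets n (⋃? (R? ∘ fsuc))) ⟩
  a * countSubsets n (R? fzero) + a * countSubsets n (⋃? (R? ∘ fsuc))
    ≤⟨ +-mono-≤ (bound fzero) (countSubsets-⋃ n m (R? ∘ fsuc) a (bound ∘ fsuc)) ⟩
  b + m * b ∎
  where
  open ≤-Reasoning
  split : ⋃ (Fin (suc m)) R ⊆ R fzero ∪ ⋃ (Fin m) (R ∘ fsuc)
  split (fzero  , r) = inj₁ r
  split (fsuc x , r) = inj₂ (x , r)

Ignores : ∀ {n} → Pred (Subset n) ℓ → Fin n → Set ℓ
Ignores P p = ∀ {s} b → P s → P (s [ p ]≔ b)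

countSubsets-∉ : ∀ n {P : Pred (Subset n) ℓ} (P? : Decidable P) p → Ignores P p →
                 2 * countSubsets n (P? ∩? ∁? (p ∈?_)) ≡ countSubsets n P?
countSubsets-∉ (suc n) {P} P? fzero ignores = begin
  2 * (countSubsets n (D ∘ (inside ∷_)) + countSubsets n (D ∘ (outside ∷_)))
    ≡⟨ cong (λ c → 2 * (c + countSubsets n (D ∘ (outside ∷_)))) none-inside ⟩
  2 * countSubsets n (D ∘ (outside ∷_))
    ≡⟨ cong (countSubsets n (D ∘ (outside ∷_)) +_) (+-identityʳ _) ⟩
  countSubsets n (D ∘ (outside ∷_)) + countSubsets n (D ∘ (outside ∷_))
    ≡⟨ cong₂ _+_ (trans all-outside (sym inside≡outside)) all-outside ⟩
  countSubsets n (P? ∘ (inside ∷_)) + countSubsets n (P? ∘ (outside ∷_)) ∎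
  where
  open ≡-Reasoning
  D : Decidable (P ∩ ∁ (fzero ∈_))
  D = P? ∩? ∁? (fzero ∈?_)
  none-inside : countSubsets n (D ∘ (inside ∷_)) ≡ 0
  none-inside = trans (countSubsets-cong n (D ∘ (inside ∷_)) ∅? ((λ (_ , ∉) → ∉ here) , λ ()))
                      (countSubsets-∅ n)
  all-outside : countSubsets n (D ∘ (outside ∷_)) ≡ countSubsets n (P? ∘ (outside ∷_))
  all-outside = countSubsets-cong n _ _ (proj₁ , λ p → p , λ ())
  inside≡outside : countSubsets n (P? ∘ (inside ∷_)) ≡ countSubsets n (P? ∘ (outside ∷_))
  inside≡outside = countSubsets-cong n _ _ (ignores outside , ignores inside)
countSubsets-∉ (suc n) {P} P? (fsuc p) ignores = begin
  2 * (countSubsets n (D ∘ (inside ∷_)) + countSubsets n (D ∘ (outside ∷_)))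
    ≡⟨ *-distribˡ-+ 2 (countSubsets n (D ∘ (inside ∷_))) (countSubsets n (D ∘ (outside ∷_))) ⟩
  2 * countSubsets n (D ∘ (inside ∷_)) + 2 * countSubsets n (D ∘ (outside ∷_))
    ≡⟨ cong₂ _+_ (halve inside) (halve outside) ⟩
  countSubsets n (P? ∘ (inside ∷_)) + countSubsets n (P? ∘ (outside ∷_)) ∎
  where
  open ≡-Reasoning
  D : Decidable (P ∩ ∁ (fsuc p ∈_))
  D = P? ∩? ∁? (fsuc p ∈?_)
  halve : ∀ x → 2 * countSubsets n (D ∘ (x ∷_)) ≡ countSubsets n (P? ∘ (x ∷_))
  halve x = begin
    2 * countSubsets n (D ∘ (x ∷_))
      ≡⟨ cong (2 *_) (countSubsets-cong n _ _
           ((λ (Px , ∉) → Px , ∉ ∘ there) , λ (Px , ∉) → Px , λ { (there ∈) → ∉ ∈ })) ⟩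
    2 * countSubsets n ((P? ∘ (x ∷_)) ∩? ∁? (p ∈?_))
      ≡⟨ countSubsets-∉ n (P? ∘ (x ∷_)) p ignores ⟩
    countSubsets n (P? ∘ (x ∷_)) ∎

Avoids : ∀ {m n} → (Fin m → Fin n) → Pred (Subset n) 0ℓ
Avoids h s = ∀ t → h t ∉ s

avoids? : ∀ {m n} (h : Fin m → Fin n) → Decidable (Avoids h)
avoids? h s = all? (λ t → ¬? (h t ∈? s))

∉-[]≔ : ∀ {n} {x p : Fin n} {s} b → x ≢ p → x ∉ s → x ∉ s [ p ]≔ b
∉-[]≔ {x = x} {s = s} b x≢p x∉s x∈s′ =
  x∉s (lookup⇒[]= x s (trans (sym (lookup∘update′ x≢p s b)) ([]=⇒lookup x∈s′)))

countSubsets-Avoids : ∀ n m (h : Fin m → Fin n) → Injective _≡_ _≡_ h →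
                      2 ^ m * countSubsets n (avoids? h) ≡ 2 ^ n
countSubsets-Avoids n zero h _ = begin
  1 * countSubsets n (avoids? h) ≡⟨ *-identityˡ _ ⟩
  countSubsets n (avoids? h)     ≡⟨ countSubsets-cong n (avoids? h) U? (_ , λ _ ()) ⟩
  countSubsets n U?              ≡⟨ countSubsets-U n ⟩
  2 ^ n                          ∎
  where open ≡-Reasoning
countSubsets-Avoids n (suc m) h h-injective = begin
  2 * 2 ^ m * countSubsets n (avoids? h)
    ≡⟨ cong (_* countSubsets n (avoids? h)) (*-comm 2 (2 ^ m)) ⟩
  2 ^ m * 2 * countSubsets n (avoids? h)
    ≡⟨ *-assoc (2 ^ m) 2 _ ⟩
  2 ^ m * (2 * countSubsets n (avoids? h))
    ≡⟨ cong (λ c → 2 ^ m * (2 * c)) (countSubsets-cong n _ _ (split , join)) ⟩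
  2 ^ m * (2 * countSubsets n (avoids? (h ∘ fsuc) ∩? ∁? (h fzero ∈?_)))
    ≡⟨ cong (2 ^ m *_) (countSubsets-∉ n (avoids? (h ∘ fsuc)) (h fzero) ignores) ⟩
  2 ^ m * countSubsets n (avoids? (h ∘ fsuc))
    ≡⟨ countSubsets-Avoids n m (h ∘ fsuc) (Finₚ.suc-injective ∘ h-injective) ⟩
  2 ^ n ∎
  where
  open ≡-Reasoning
  split : Avoids h ⊆ Avoids (h ∘ fsuc) ∩ ∁ (h fzero ∈_)
  split avoids = avoids ∘ fsuc , avoids fzero
  join : Avoids (h ∘ fsuc) ∩ ∁ (h fzero ∈_) ⊆ Avoids h
  join (avoids , h₀∉) = ∀-cons h₀∉ avoids
  ignores : Ignores (Avoids (h ∘ fsuc)) (h fzero)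
  ignores b avoids t = ∉-[]≔ b (Finₚ.0≢1+n ∘ sym ∘ h-injective) (avoids t)

module _ {q : ℕ} (F : FiniteField q) where
  open FiniteField F

  line : Fin q → Fin q → Fin q → Fin (q * q)
  line i j t = point t (i +F (j *F t))

  line-injective : ∀ i j → Injective _≡_ _≡_ (line i j)
  line-injective i j {t} {u} = combine-injectiveˡ t _ u _

  ¬blocking⇒avoids-line : ∀ {S} → ¬ IsBlockingSet F S → ∃[ i ] ∃[ j ] Avoids (line i j) S
  ¬blocking⇒avoids-line {S} ¬blocking
    with i , ¬meets-i ← ¬∀⟶∃¬ q _ (λ i → all? (λ j → any? (λ t → line i j t ∈? S))) ¬blocking
    with j , ¬meets-ij ← ¬∀⟶∃¬ q _ (λ j → any? (λ t → line i j t ∈? S)) ¬meets-i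
    = i , j , λ t t∈S → ¬meets-ij (t , t∈S)

  countSubsets-¬blocking :
    2 ^ q * countSubsets (q * q) (∁? (isBlockingSet? F)) ≤ q * q * 2 ^ (q * q)
  countSubsets-¬blocking = begin
    2 ^ q * countSubsets (q * q) (∁? (isBlockingSet? F))
      ≤⟨ *-monoʳ-≤ (2 ^ q) (countSubsets-mono (q * q) _ avoids-some-line? ¬blocking⇒avoids-line) ⟩
    2 ^ q * countSubsets (q * q) avoids-some-line?
      ≤⟨ countSubsets-⋃ (q * q) q avoids-line? (2 ^ q) (λ i →
           countSubsets-⋃ (q * q) q (avoids? ∘ line i) (2 ^ q) (λ j →
           ≤-reflexive (countSubsets-Avoids (q * q) q (line i j) (line-injective i j)))) ⟩
    q * (q * 2 ^ (q * q))
      ≡⟨ *-assoc q q (2 ^ (q * q)) ⟨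
    q * q * 2 ^ (q * q) ∎
    where
    open ≤-Reasoning
    avoids-line? : ∀ i → Decidable (⋃ (Fin q) (Avoids ∘ line i))
    avoids-line? i = ⋃? (avoids? ∘ line i)
    avoids-some-line? : Decidable (⋃ (Fin q) (λ i → ⋃ (Fin q) (Avoids ∘ line i)))
    avoids-some-line? = ⋃? avoids-line?

cube-suc≤2*cube : ∀ n → 4 ≤ n → suc n * (suc n * suc n) ≤ 2 * (n * (n * n))
cube-suc≤2*cube n 4≤n with r , refl ← m≤n⇒∃[o]m+o≡n 4≤n = begin
  suc (4 + r) * (suc (4 + r) * suc (4 + r))
    ≤⟨ m≤m+n _ (r * (r * r) + 9 * (r * r) + 21 * r + 3) ⟩
  suc (4 + r) * (suc (4 + r) * suc (4 + r)) + (r * (r * r) + 9 * (r * r) + 21 * r + 3)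
    ≡⟨ expand r ⟩
  2 * ((4 + r) * ((4 + r) * (4 + r))) ∎
  where
  open ≤-Reasoning
  expand : ∀ r →
    suc (4 + r) * (suc (4 + r) * suc (4 + r)) + (r * (r * r) + 9 * (r * r) + 21 * r + 3)
      ≡ 2 * ((4 + r) * ((4 + r) * (4 + r)))
  expand = solve-∀

cube≤2^ : ∀ r → (10 + r) * ((10 + r) * (10 + r)) ≤ 2 ^ (10 + r)
cube≤2^ zero    = ≤ᵇ⇒≤ 1000 1024 _
cube≤2^ (suc r) = begin
  suc n * (suc n * suc n) ≤⟨ cube-suc≤2*cube n (m≤m+n 4 (6 + r)) ⟩
  2 * (n * (n * n))       ≤⟨ *-monoʳ-≤ 2 (cube≤2^ r) ⟩
  2 * 2 ^ n               ∎
  where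
  open ≤-Reasoning
  n : ℕ
  n = 10 + r

suc[k]*square≤2^ : ∀ k q → 10 + k ≤ q → suc k * (q * q) ≤ 2 ^ q
suc[k]*square≤2^ k q 10+k≤q with r , refl ← m≤n⇒∃[o]m+o≡n 10+k≤q = begin
  suc k * (q * q) ≤⟨ *-monoˡ-≤ (q * q) (≤-trans (m≤n+m (suc k) 9) 10+k≤q) ⟩
  q * (q * q)     ≤⟨ cube≤2^ (k + r) ⟩
  2 ^ q           ∎
  where open ≤-Reasoning

share≤1/[1+k] : ∀ k r p {m t} .{{_ : NonZero p}} → p * m ≤ r * t → suc k * r ≤ p → suc k * m ≤ t
share≤1/[1+k] k r p {m} {t} pm≤rt k+1[r]≤p = *-cancelˡ-≤ p (begin
  p * (suc k * m) ≡⟨ x∙yz≈y∙xz p (suc k) m ⟩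
  suc k * (p * m) ≤⟨ *-monoʳ-≤ (suc k) pm≤rt ⟩
  suc k * (r * t) ≡⟨ *-assoc (suc k) r t ⟨
  suc k * r * t   ≤⟨ *-monoˡ-≤ t k+1[r]≤p ⟩
  p * t           ∎)
  where open ≤-Reasoning

complement-share≥k/[1+k] : ∀ k {b m t} → b + m ≡ t → suc k * m ≤ t → k * t ≤ suc k * b
complement-share≥k/[1+k] k {b} {m} {t} b+m≡t k+1[m]≤t =
  +-cancelʳ-≤ (suc k * m) (k * t) (suc k * b) (begin
    k * t + suc k * m     ≤⟨ +-monoʳ-≤ (k * t) k+1[m]≤t ⟩
    k * t + t             ≡⟨ +-comm (k * t) t ⟩
    suc k * t             ≡⟨ cong (suc k *_) b+m≡t ⟨
    suc k * (b + m)       ≡⟨ *-distribˡ-+ (suc k) b m ⟩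
    suc k * b + suc k * m ∎)
  where open ≤-Reasoning

proposition6p8 : ∀ (k : ℕ) → ∃[ Q ] (∀ (q : ℕ) → Q ≤ q → (F : FiniteField q) →
                   k * 2 ^ (q * q) ≤ suc k * numBlockingSets F)
proposition6p8 k = 10 + k , λ q 10+k≤q F →
  complement-share≥k/[1+k] k (countSubsets-∁ (q * q) (isBlockingSet? F))
    (share≤1/[1+k] k (q * q) (2 ^ q) {{m^n≢0 2 q}}
      (countSubsets-¬blocking F) (suc[k]*square≤2^ k q 10+k≤q))
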